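{- In any transition system $(\mathrm{Proc},\mathsf{Act},\rightarrow,\uparrow)$, let $p,q\in\mathrm{Proc}$, $\mathsf{sort}(p)\subseteq A\subseteq\mathsf{Act}$ and $\lambda$ an ordinal. If $p\not\lesssim_\lambda q$ then $\mathcal{L}^{(A,\lambda)}_\infty(p)\not\subseteq\mathcal{L}^{(A,\lambda)}_\infty(q)$.
   Context: A transition system is $(\mathrm{Proc},\mathsf{Act},\rightarrow,\uparrow)$ with ${\rightarrow}\subseteq\mathrm{Proc}\times\mathsf{Act}\times\mathrm{Proc}$ (written $p\xrightarrow{a}q$) and ${\uparrow}\subseteq\mathrm{Proc}$; $p\downarrow$ means not $p\uparrow$. $\mathsf{sort}(p)=\{a:\exists q,r.\,p\rightarrow^{*}q\xrightarrow{a}r\}$ where $\rightarrow^*$ is the reflexive transitive closure of $\bigcup_a\xrightarrow{a}$. Relations $\lesssim_\alpha$: $\lesssim_0$ total; $p\lesssim_{\alpha+1}q$ iff for all $a$: (1) $p\xrightarrow{a}p'$ implies $\exists q'.\,q\xrightarrow{a}q'\wedge p'\lesssim_\alpha q'$; (2) $p\downarrow$ implies $q\downarrow$ and ($q\xrightarrow{a}q'$ implies $\exists p'.\,p\xrightarrow{a}p'\wedge p'\lesssim_\alpha q'$); at limits intersections. The logic $\mathcal{L}_\infty$ has sorts $\pi,\kappa$: arbitrary (set-indexed) conjunctions and disjunctions within each sort; $a(\phi)$ of sort $\kappa$ for $a\in\mathsf{Act}$ and $\phi$ of sort $\pi$; $\Box\phi,\Diamond\phi$ of sort $\pi$ for $\phi$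 of sort $\kappa$. With $C(p)=\{\bot:p\uparrow\}\cup\{\langle a,q\rangle:p\xrightarrow{a}q\}$: $p\models\Box\phi$ iff all $c\in C(p)$ satisfy $\phi$; $p\models\Diamond\phi$ iff some $c\in C(p)\cup\{\bot\}$ satisfies $\phi$; $c\models a(\phi)$ iff $c=\langle a,q\rangle$ and $q\models\phi$; Boolean connectives as usual. $\mathsf{md}$: sup over conjunctions/disjunctions, $\mathsf{md}(a(\phi))=\mathsf{md}(\phi)$, $\mathsf{md}(\Box\phi)=\mathsf{md}(\Diamond\phi)=\mathsf{md}(\phi)+1$; $\mathsf{sort}(\phi)$ = actions occurring in $\phi$. $\mathcal{L}^{(A,\lambda)}_\infty(p)$ is the set of sort-$\pi$ formulas $\phi$ with $\mathsf{sort}(\phi)\subseteq A$, $\mathsf{md}(\phi)\le\lambda$ and $p\models\phi$. -}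

module Defs where

open import Level using (Level; suc; _⊔_)
open import Data.Empty.Polymorphic using (⊥)
open import Data.Product using (Σ; ∃; _×_; _,_)
open import Data.Sum using (_⊎_)
open import Relation.Nullary using (¬_)
open import Relation.Binary.PropositionalEquality using (_≡_)
open import Relation.Binary.Construct.Closure.ReflexiveTransitive using (Star)

-- A transition system (Proc, Act, →, ↑); all components live in one universe level ℓ,
-- which is also the universe of index sets of infinitary conjunctions/disjunctions
-- and of the branching of ordinals.
record TS (ℓ : Level) : Set (suc ℓ) where
  field
    Proc : Set ℓ
    Act  : Set ℓ
    _—[_]→_ : Proc → Act → Proc → Set ℓ
    _↑ : Proc → Set ℓ

-- Ordinals, represented as well-founded trees with branching over arbitrary sets of
-- level ℓ: the ordinal  sup I f  is the least ordinal strictly above every f i.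
-- (Every ordinal λ is represented, e.g. by  sup {β | β < λ} id.)
data Ord (ℓ : Level) : Set (suc ℓ) where
  sup : (I : Set ℓ) → (I → Ord ℓ) → Ord ℓ

data Sort : Set where
  π κ : Sort

module Theory {ℓ : Level} (T : TS ℓ) where
  open TS T public

  _↓ : Proc → Set ℓ
  p ↓ = ¬ (p ↑)

  _⟶_ : Proc → Proc → Set ℓ
  p ⟶ q = ∃ λ a → p —[ a ]→ q

  _⟶*_ : Proc → Proc → Set ℓ
  _⟶*_ = Star _⟶_

  sortP : Proc → Act → Set ℓ
  sortP p a = ∃ λ q → ∃ λ r → (p ⟶* q) × (q —[ a ]→ r)

  -- the approximants ≲_α.  ≲_(sup I f) = ⋂_{i∈I} F(≲_(f i)), where F is the
  -- one-step operator given by clauses (1),(2). This gives: ≲_0 total,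
  -- ≲_(α+1) = F(≲_α), and intersections at limits.
  _≲[_]_ : Proc → Ord ℓ → Proc → Set ℓ
  p ≲[ sup I f ] q = (i : I) →
      ((a : Act) (p' : Proc) → p —[ a ]→ p' → ∃ λ q' → (q —[ a ]→ q') × (p' ≲[ f i ] q'))
    × (p ↓ → (q ↓) × ((a : Act) (q' : Proc) → q —[ a ]→ q' →
                          ∃ λ p' → (p —[ a ]→ p') × (p' ≲[ f i ] q')))

  data Form : Sort → Set (suc ℓ) where
    ⋀ : {s : Sort} (I : Set ℓ) → (I → Form s) → Form s
    ⋁ : {s : Sort} (I : Set ℓ) → (I → Form s) → Form s
    act : Act → Form π → Form κ
    □ : Form κ → Form π
    ◇ : Form κ → Form π

  data Cand : Set ℓ where
    ⊥c : Cand
    ⟨_,_⟩ : Act → Proc → Cand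

  data _∈C_ : Cand → Proc → Set ℓ where
    div : {p : Proc} → p ↑ → ⊥c ∈C p
    tr  : {p q : Proc} {a : Act} → p —[ a ]→ q → ⟨ a , q ⟩ ∈C p

  mutual
    _⊨_ : Proc → Form π → Set ℓ
    p ⊨ ⋀ I φ = (i : I) → p ⊨ φ i
    p ⊨ ⋁ I φ = Σ I λ i → p ⊨ φ i
    p ⊨ □ φ = (c : Cand) → c ∈C p → c ⊨κ φ
    p ⊨ ◇ φ = ∃ λ c → (c ∈C p ⊎ c ≡ ⊥c) × (c ⊨κ φ)

    _⊨κ_ : Cand → Form κ → Set ℓ
    c ⊨κ ⋀ I φ = (i : I) → c ⊨κ φ i
    c ⊨κ ⋁ I φ = Σ I λ i → c ⊨κ φ i
    ⊥c ⊨κ act a φ = ⊥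
    ⟨ b , q ⟩ ⊨κ act a φ = (b ≡ a) × (q ⊨ φ)

  occurs : {s : Sort} → Form s → Act → Set ℓ
  occurs (⋀ I φ) a = Σ I λ i → occurs (φ i) a
  occurs (⋁ I φ) a = Σ I λ i → occurs (φ i) a
  occurs (act b φ) a = (a ≡ b) ⊎ occurs φ a
  occurs (□ φ) a = occurs φ a
  occurs (◇ φ) a = occurs φ a

  -- md(φ) ≤ α, unfolded along the definition of md:
  -- sup_i md(φ_i) ≤ α iff all md(φ_i) ≤ α;  md(φ)+1 ≤ sup I f iff md(φ) ≤ f i for some i.
  mdLe : {s : Sort} → Form s → Ord ℓ → Set ℓ
  mdLe (⋀ I φ) α = (i : I) → mdLe (φ i) α
  mdLe (⋁ I φ) α = (i : I) → mdLe (φ i) α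
  mdLe (act a φ) α = mdLe φ α
  mdLe (□ φ) (sup I f) = Σ I λ i → mdLe φ (f i)
  mdLe (◇ φ) (sup I f) = Σ I λ i → mdLe φ (f i)

  _⊆A_ : (Act → Set ℓ) → (Act → Set ℓ) → Set ℓ
  X ⊆A Y = (a : Act) → X a → Y a

  L : (A : Act → Set ℓ) → Ord ℓ → Proc → Form π → Set ℓ
  L A λ' p φ = (occurs φ ⊆A A) × mdLe φ λ' × (p ⊨ φ)

  LSub : (A : Act → Set ℓ) → Ord ℓ → Proc → Proc → Set (suc ℓ)
  LSub A λ' p q = (φ : Form π) → L A λ' p φ → L A λ' q φ

-- Proof via characteristic formulas.  For every ordinal α and process p we define
-- a formula  χ α p  of L_∞ which describes p "up to depth α":
--
--   χ (sup I f) p = ⋀_{i∈I} ( ⋀_{p —a→ p'} ◇ a(χ (f i) p')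
--                            ∧ [if p↓]  □ ⋁_{p —a→ p'} a(χ (f i) p') ).
--
-- The first three say that χ α p ∈ L^(A,α)(p) whenever sort(p) ⊆ A.  Hence, if
-- L^(A,α)(p) ⊆ L^(A,α)(q), then q ⊨ χ α p and therefore p ≲_α q, which is the
-- contrapositive of the theorem.
module Submission where

open import Defs
open import Level using (Level; lift)
open import Relation.Nullary using (¬_)
open import Data.Product using (Σ; ∃; _×_; _,_; proj₂)
open import Data.Sum using (_⊎_; inj₁; inj₂)
open import Data.Empty using (⊥-elim)
open import Relation.Binary.PropositionalEquality using (refl)
open import Relation.Binary.Construct.Closure.ReflexiveTransitive using (ε; _◅_)

module CharacteristicFormulas {ℓ : Level} (T : TS ℓ) where
  open Theory T

  Trans : Proc → Set ℓ
  Trans p = Σ Act λ a → Σ Proc λ p' → p —[ a ]→ p'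

  Clause : Proc → Set ℓ
  Clause p = Trans p ⊎ (p ↓)

  mutual
    χ : Ord ℓ → Proc → Form π
    χ (sup I f) p = ⋀ I λ i → ⋀ (Clause p) (clause (f i) p)

    clause : Ord ℓ → (p : Proc) → Clause p → Form π
    clause β p (inj₁ t) = ◇ (step β p t)
    clause β p (inj₂ _) = □ (⋁ (Trans p) (step β p))

    step : Ord ℓ → (p : Proc) → Trans p → Form κ
    step β p (a , p' , _) = act a (χ β p')

  χ-sat : (α : Ord ℓ) (p : Proc) → p ⊨ χ α p
  χ-sat (sup I f) p i (inj₁ (a , p' , t)) = ⟨ a , p' ⟩ , inj₁ (tr t) , refl , χ-sat (f i) p'
  χ-sat (sup I f) p i (inj₂ p↓) ⊥c (div p↑) = ⊥-elim (p↓ p↑)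
  χ-sat (sup I f) p i (inj₂ p↓) ⟨ a , p' ⟩ (tr t) = (a , p' , t) , refl , χ-sat (f i) p'

  sort-step : ∀ {p p' a b} → p —[ b ]→ p' → sortP p' a → sortP p a
  sort-step t (q , r , p'⟶*q , q—a→r) = q , r , (_ , t) ◅ p'⟶*q , q—a→r

  step-occurs : (β : Ord ℓ) (p : Proc) (t : Trans p) →
    (∀ p' → occurs (χ β p') ⊆A sortP p') → occurs (step β p t) ⊆A sortP p
  step-occurs β p (b , p' , t) ih a (inj₁ refl) = p , p' , ε , t
  step-occurs β p (b , p' , t) ih a (inj₂ o) = sort-step t (ih p' a o)

  χ-occurs : (α : Ord ℓ) (p : Proc) → occurs (χ α p) ⊆A sortP p
  χ-occurs (sup I f) p a (i , inj₁ t , o) = step-occurs (f i) p t (χ-occurs (f i)) a o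
  χ-occurs (sup I f) p a (i , inj₂ _ , t , o) = step-occurs (f i) p t (χ-occurs (f i)) a o

  -- md(χ α p) ≤ α: each clause at depth f i adds one modality to χ (f i).
  χ-md : (α : Ord ℓ) (p : Proc) → mdLe (χ α p) α
  χ-md (sup I f) p i (inj₁ (a , p' , t)) = i , χ-md (f i) p'
  χ-md (sup I f) p i (inj₂ _) = i , λ { (a , p' , t) → χ-md (f i) p' }

  χ-∈L : (A : Act → Set ℓ) (α : Ord ℓ) (p : Proc) → sortP p ⊆A A → L A α p (χ α p)
  χ-∈L A α p sp⊆A = (λ a o → sp⊆A a (χ-occurs α p a o)) , χ-md α p , χ-sat α p

  mutual
    χ-complete : (α : Ord ℓ) (p q : Proc) → q ⊨ χ α p → p ≲[ α ] q
    χ-complete (sup I f) p q q⊨χ i =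
      (λ a p' t → ◇-clause (f i) p q a p' t (q⊨χ i (inj₁ (a , p' , t)))) ,
      (λ p↓ → □-clause (f i) p q p↓ (q⊨χ i (inj₂ p↓)))

    ◇-clause : (β : Ord ℓ) (p q : Proc) (a : Act) (p' : Proc) (t : p —[ a ]→ p') →
      q ⊨ clause β p (inj₁ (a , p' , t)) →
      ∃ λ q' → (q —[ a ]→ q') × (p' ≲[ β ] q')
    ◇-clause β p q a p' t (⟨ _ , q' ⟩ , inj₁ (tr t') , refl , q'⊨χ) =
      q' , t' , χ-complete β p' q' q'⊨χ
    ◇-clause β p q a p' t (⊥c , _ , lift ())
    ◇-clause β p q a p' t (⟨ _ , _ ⟩ , inj₂ () , _)

    □-clause : (β : Ord ℓ) (p q : Proc) (p↓ : p ↓) → q ⊨ clause β p (inj₂ p↓) →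
      (q ↓) × ((a : Act) (q' : Proc) → q —[ a ]→ q' →
                 ∃ λ p' → (p —[ a ]→ p') × (p' ≲[ β ] q'))
    □-clause β p q p↓ q⊨□ = q↓ , match
      where
      q↓ : q ↓
      q↓ q↑ with q⊨□ ⊥c (div q↑)
      ... | _ , lift ()
      match : (a : Act) (q' : Proc) → q —[ a ]→ q' →
              ∃ λ p' → (p —[ a ]→ p') × (p' ≲[ β ] q')
      match a q' t' with q⊨□ ⟨ a , q' ⟩ (tr t')
      ... | (_ , p' , t) , refl , q'⊨χ = p' , t , χ-complete β p' q' q'⊨χ

-- If L^(A,λ)(p) ⊆ L^(A,λ)(q) then q satisfies χ λ p ∈ L^(A,λ)(p), so p ≲_λ q.
mainTheorem4 : {ℓ : Level} (T : TS ℓ) → let open Theory T in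
    (p q : Proc) (A : Act → Set ℓ) (λ' : Ord ℓ) →
    sortP p ⊆A A →
    ¬ (p ≲[ λ' ] q) →
    ¬ LSub A λ' p q
mainTheorem4 T p q A λ' sp⊆A p≴q Lp⊆Lq =
  p≴q (χ-complete λ' p q (proj₂ (proj₂ (Lp⊆Lq (χ λ' p) (χ-∈L A λ' p sp⊆A)))))
  where
  open CharacteristicFormulas T
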